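{- Let $d\ge1$ and $n$ be positive integers and $D=\binom{n}{d}$. Every edge $e$ of $Q_n^d$ is contained in at most $O(3^{3d}D^4)$ pure paths (with an absolute implied constant).
   Context: $Q_n^d$ is the graph on $\{0,1\}^n$ where $x,y$ are adjacent iff their Hamming distance is $d$. For $x,y\in\{0,1\}^n$, $x\oplus y$ is the coordinatewise sum mod 2, $\mathrm{supp}(z)=\{i: z_i=1\}$, and $S_d=\{z\in\{0,1\}^n: |\mathrm{supp}(z)|=d\}$. Pure path: let $x,y\in\{0,1\}^n$ have Hamming distance $3d$. Let $f_1,f_2,f_3\in S_d$ be such that $\mathrm{supp}(f_1)$, $\mathrm{supp}(f_2)$, $\mathrm{supp}(f_3)$ are respectively the first $d$, the second $d$, and the last $d$ elements (in increasing order) of $\mathrm{supp}(x\oplus y)$, so $x\oplus y=f_1\oplus f_2\oplus f_3$. Let $t,u\in S_d$ be such that $\mathrm{supp}(t)$, $\mathrm{supp}(u)$, $\mathrm{supp}(x\oplus y)$ are pairwise disjoint. The path with vertices $x_0=x$, $x_1=x\oplus t$, $x_2=x\oplus t\oplus u$, $x_3=x_2\oplus f_1$, $x_4=x_3\oplus f_2$, $x_5=y\oplus t\oplus u$, $x_6=y\oplus u$, $x_7=y$ (a path of length 7 in $Q_n^d$) is a pure path between $x$ and $y$. -}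

module Defs where

open import Data.Bool using (Bool; true; false; _xor_; _∧_)
open import Data.Bool.Properties using () renaming (_≟_ to _≟ᵇ_)
open import Data.Nat using (ℕ; zero; suc; _+_; _*_)
open import Data.Nat.Properties using () renaming (_≟_ to _≟ℕ_)
open import Data.Vec using (Vec; []; _∷_; zipWith)
open import Data.Vec.Properties using (≡-dec)
open import Data.List using (List; []; _∷_; _++_; map; length; filter; cartesianProduct)
open import Data.List.Relation.Unary.Any using (Any)
import Data.List.Relation.Unary.Any as Any
open import Data.Product using (_×_; _,_)
open import Data.Sum using (_⊎_)
open import Relation.Binary.PropositionalEquality using (_≡_)
open import Relation.Nullary using (Dec)
open import Relation.Nullary.Decidable using (_×-dec_; _⊎-dec_)

-- Vertices of Q_n^d: binary words of length n (position i = coordinate i,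
-- listed in increasing order of coordinates).
Word : ℕ → Set
Word n = Vec Bool n

_⊕_ : ∀ {n} → Word n → Word n → Word n
_⊕_ = zipWith _xor_

weight : ∀ {n} → Word n → ℕ
weight []           = 0
weight (true  ∷ z)  = suc (weight z)
weight (false ∷ z)  = weight z

hamming : ∀ {n} → Word n → Word n → ℕ
hamming x y = weight (x ⊕ y)

Disjoint : ∀ {n} → Word n → Word n → Set
Disjoint a b = weight (zipWith _∧_ a b) ≡ 0

firstOnes : ∀ {n} → ℕ → Word n → Word n
firstOnes k       []          = []
firstOnes zero    (b ∷ z)     = false ∷ firstOnes zero z
firstOnes (suc k) (true ∷ z)  = true ∷ firstOnes k z
firstOnes (suc k) (false ∷ z) = false ∷ firstOnes (suc k) z

-- f₁ : first d elements of supp(x ⊕ y);  f₂ : second d elements.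
f₁ : ∀ {n} → ℕ → Word n → Word n → Word n
f₁ d x y = firstOnes d (x ⊕ y)

f₂ : ∀ {n} → ℕ → Word n → Word n → Word n
f₂ d x y = firstOnes d ((x ⊕ y) ⊕ f₁ d x y)

-- The data (x , y , t , u) determining a pure path.
Quad : ℕ → Set
Quad n = Word n × Word n × Word n × Word n

IsPure : ∀ {n} → ℕ → Quad n → Set
IsPure d (x , y , t , u) =
  hamming x y ≡ 3 * d × weight t ≡ d × weight u ≡ d ×
  Disjoint t u × Disjoint t (x ⊕ y) × Disjoint u (x ⊕ y)

pathVertices : ∀ {n} → ℕ → Quad n → List (Word n)
pathVertices d (x , y , t , u) =
  let x₁ = x ⊕ t
      x₂ = x₁ ⊕ u
      x₃ = x₂ ⊕ f₁ d x y
      x₄ = x₃ ⊕ f₂ d x y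
      x₅ = (y ⊕ t) ⊕ u
      x₆ = y ⊕ u
  in x ∷ x₁ ∷ x₂ ∷ x₃ ∷ x₄ ∷ x₅ ∷ x₆ ∷ y ∷ []

consecutive : ∀ {A : Set} → List A → List (A × A)
consecutive []           = []
consecutive (a ∷ [])     = []
consecutive (a ∷ b ∷ xs) = (a , b) ∷ consecutive (b ∷ xs)

ContainsEdge : ∀ {n} → ℕ → Word n → Word n → Quad n → Set
ContainsEdge d a b q =
  Any (λ { (p , r) → (p ≡ a × r ≡ b) ⊎ (p ≡ b × r ≡ a) }) (consecutive (pathVertices d q))

_≟w_ : ∀ {n} (a b : Word n) → Dec (a ≡ b)
_≟w_ = ≡-dec _≟ᵇ_

isPure? : ∀ {n} d (q : Quad n) → Dec (IsPure d q)
isPure? d (x , y , t , u) =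
  (hamming x y ≟ℕ 3 * d) ×-dec (weight t ≟ℕ d) ×-dec (weight u ≟ℕ d) ×-dec
  (weight (zipWith _∧_ t u) ≟ℕ 0) ×-dec (weight (zipWith _∧_ t (x ⊕ y)) ≟ℕ 0) ×-dec
  (weight (zipWith _∧_ u (x ⊕ y)) ≟ℕ 0)

containsEdge? : ∀ {n} d (a b : Word n) (q : Quad n) → Dec (ContainsEdge d a b q)
containsEdge? d a b q =
  Any.any? (λ { (p , r) → ((p ≟w a) ×-dec (r ≟w b)) ⊎-dec ((p ≟w b) ×-dec (r ≟w a)) })
           (consecutive (pathVertices d q))

allWords : (n : ℕ) → List (Word n)
allWords zero    = [] ∷ []
allWords (suc n) = map (false ∷_) (allWords n) ++ map (true ∷_) (allWords n)

allQuads : (n : ℕ) → List (Quad n)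
allQuads n = cartesianProduct (allWords n)
               (cartesianProduct (allWords n) (cartesianProduct (allWords n) (allWords n)))

-- number of pure paths of Q_n^d containing the edge {a,b}
-- (pure paths counted by their defining data (x,y,t,u), equivalently by
--  their vertex sequences x₀,…,x₇, which determine (x,y,t,u))
pureCount : ∀ {n} → ℕ → Word n → Word n → ℕ
pureCount {n} d a b =
  length (filter (λ q → isPure? d q ×-dec containsEdge? d a b q) (allQuads n))

-- A pure path is the translate x ⊕ P of a template path P from 0 to z = x ⊕ y that depends only on
-- (z, t, u) and whose seven steps are t, u, f₁, f₂, f₃, t, u with f₁, f₂, f₃ ⊑ z. If the path uses the
-- edge {a, b} along the template edge (o, o′), then x ∈ {a ⊕ o, b ⊕ o} and the step o ⊕ o′ equals
-- c = a ⊕ b, so t = c, or u = c, or c ⊑ z and then z is at distance 2d from c. Hence a pure path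
-- through {a, b} is fixed by one of 7 · 2 choices of (template edge, endpoint) and a triple (z, t, u)
-- from a set of size at most 2 C(n,3d) D + C(n,2d) D² ≤ 3 D⁴, as C(n, kd) ≤ Dᵏ. This gives K = 42
-- even without the factor 3^{3d}, and uses only the weights of z, t, u, not the disjointness conditions.

module Submission where

open import Defs
open import Data.Nat using (ℕ; _*_; _^_; _≤_)
open import Data.Nat.Combinatorics using (_C_)
open import Data.Product using (∃)
open import Relation.Binary.PropositionalEquality using (_≡_)

open import Data.Bool as Bool using (true; false; f≤t; b≤b)
open import Data.Bool.Properties using (xor-assoc; xor-comm; xor-identityˡ; xor-same) renaming (≤-trans to ≤ᵇ-trans)
open import Data.Nat using (zero; suc; _+_; z≤n; s≤s)
open import Data.Nat.Combinatorics using (nCk+nC[k+1]≡[n+1]C[k+1])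
open import Data.Nat.Properties
open import Data.Nat.Solver using (module +-*-Solver)
open import Data.List using (List; []; _∷_; _++_; map; length; concatMap; cartesianProduct)
open import Data.List.Properties using (length-++; length-map; length-++-sucʳ)
open import Data.List.Membership.Propositional using (_∈_; find; lose)
open import Data.List.Membership.Propositional.Properties
  using (∈-map⁺; ∈-map⁻; ∈-++⁺ˡ; ∈-++⁺ʳ; ∈-++⁻; ∈-∃++; ∈-concatMap⁺; ∈-cartesianProduct⁺; ∈-filter⁻)
open import Data.List.Relation.Binary.Disjoint.Propositional renaming (Disjoint to DisjointLists)
open import Data.List.Relation.Binary.Pointwise as ListPointwise using ([]; _∷_)
open import Data.List.Relation.Binary.Subset.Propositional using (_⊆_)
open import Data.List.Relation.Unary.All as All using (All; []; _∷_)
open import Data.List.Relation.Unary.AllPairs using ([]; _∷_)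
open import Data.List.Relation.Unary.Any using (Any; here; there)
import Data.List.Relation.Unary.Any.Properties as Any
open import Data.List.Relation.Unary.Unique.Propositional using (Unique)
import Data.List.Relation.Unary.Unique.Propositional.Properties as Unique
open import Data.Product as Product using (_×_; _,_)
open import Data.Sum using (_⊎_; inj₁; inj₂)
open import Data.Vec using ([]; _∷_; replicate)
open import Data.Vec.Properties using (∷-injectiveʳ)
open import Data.Vec.Relation.Binary.Pointwise.Inductive as Pointwise
  using (Pointwise; []; _∷_; Pointwise-≡⇒≡; zipWith-assoc; zipWith-comm; zipWith-identityˡ)
open import Relation.Nullary using (contradiction)
open import Relation.Nullary.Decidable using (_×-dec_)
open import Relation.Binary.PropositionalEquality using (refl; sym; trans; cong; cong₂; subst; module ≡-Reasoning)

private variable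
  n : ℕ
  A B : Set

zeros : ∀ n → Word n
zeros n = replicate n false

⊕-assoc : (x y z : Word n) → (x ⊕ y) ⊕ z ≡ x ⊕ (y ⊕ z)
⊕-assoc x y z = Pointwise-≡⇒≡ (zipWith-assoc xor-assoc x y z)

⊕-comm : (x y : Word n) → x ⊕ y ≡ y ⊕ x
⊕-comm x y = Pointwise-≡⇒≡ (zipWith-comm xor-comm x y)

⊕-identityˡ : (x : Word n) → zeros n ⊕ x ≡ x
⊕-identityˡ x = Pointwise-≡⇒≡ (zipWith-identityˡ xor-identityˡ x)

⊕-identityʳ : (x : Word n) → x ⊕ zeros n ≡ x
⊕-identityʳ {n} x = trans (⊕-comm x (zeros n)) (⊕-identityˡ x)

⊕-self : (x : Word n) → x ⊕ x ≡ zeros n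
⊕-self []      = refl
⊕-self (b ∷ x) = cong₂ _∷_ (xor-same b) (⊕-self x)

⊕-cancelˡ : (x y : Word n) → x ⊕ (x ⊕ y) ≡ y
⊕-cancelˡ {n} x y = begin
  x ⊕ (x ⊕ y)  ≡⟨ ⊕-assoc x x y ⟨
  (x ⊕ x) ⊕ y  ≡⟨ cong (_⊕ y) (⊕-self x) ⟩
  zeros n ⊕ y  ≡⟨ ⊕-identityˡ y ⟩
  y            ∎
  where open ≡-Reasoning

⊕-cancelʳ : (x y : Word n) → (x ⊕ y) ⊕ y ≡ x
⊕-cancelʳ x y = trans (⊕-comm (x ⊕ y) y) (trans (cong (y ⊕_) (⊕-comm x y)) (⊕-cancelˡ y x))

⊕-cancel-common : (w x y : Word n) → (w ⊕ x) ⊕ (w ⊕ y) ≡ x ⊕ y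
⊕-cancel-common w x y = begin
  (w ⊕ x) ⊕ (w ⊕ y)  ≡⟨ ⊕-assoc w x (w ⊕ y) ⟩
  w ⊕ (x ⊕ (w ⊕ y))  ≡⟨ cong (w ⊕_) (⊕-assoc x w y) ⟨
  w ⊕ ((x ⊕ w) ⊕ y)  ≡⟨ cong (λ v → w ⊕ (v ⊕ y)) (⊕-comm x w) ⟩
  w ⊕ ((w ⊕ x) ⊕ y)  ≡⟨ cong (w ⊕_) (⊕-assoc w x y) ⟩
  w ⊕ (w ⊕ (x ⊕ y))  ≡⟨ ⊕-cancelˡ w (x ⊕ y) ⟩
  x ⊕ y              ∎
  where open ≡-Reasoning

⊕-translate : ∀ {v x o s : Word n} → v ≡ x ⊕ o → v ⊕ s ≡ x ⊕ (o ⊕ s)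
⊕-translate {x = x} {o} {s} refl = ⊕-assoc x o s

infix 4 _⊑_

_⊑_ : Word n → Word n → Set
_⊑_ = Pointwise Bool._≤_

⊑-trans : {x y z : Word n} → x ⊑ y → y ⊑ z → x ⊑ z
⊑-trans = Pointwise.trans ≤ᵇ-trans

firstOnes-⊑ : ∀ k (z : Word n) → firstOnes k z ⊑ z
firstOnes-⊑ k       []          = []
firstOnes-⊑ zero    (false ∷ z) = b≤b ∷ firstOnes-⊑ zero z
firstOnes-⊑ zero    (true ∷ z)  = f≤t ∷ firstOnes-⊑ zero z
firstOnes-⊑ (suc k) (false ∷ z) = b≤b ∷ firstOnes-⊑ (suc k) z
firstOnes-⊑ (suc k) (true ∷ z)  = b≤b ∷ firstOnes-⊑ k z

⊕-⊑ : {x z : Word n} → x ⊑ z → z ⊕ x ⊑ z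
⊕-⊑ []                  = []
⊕-⊑ (f≤t ∷ x⊑z)         = b≤b ∷ ⊕-⊑ x⊑z
⊕-⊑ (b≤b {false} ∷ x⊑z) = b≤b ∷ ⊕-⊑ x⊑z
⊕-⊑ (b≤b {true} ∷ x⊑z)  = f≤t ∷ ⊕-⊑ x⊑z

weight-⊑ : {x z : Word n} → x ⊑ z → weight (z ⊕ x) + weight x ≡ weight z
weight-⊑ []                  = refl
weight-⊑ (f≤t ∷ x⊑z)         = cong suc (weight-⊑ x⊑z)
weight-⊑ (b≤b {false} ∷ x⊑z) = weight-⊑ x⊑z
weight-⊑ {x = _ ∷ x} {z = _ ∷ z} (b≤b {true} ∷ x⊑z) =
  trans (+-suc (weight (z ⊕ x)) (weight x)) (cong suc (weight-⊑ x⊑z))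

length-cartesianProduct : (xs : List A) (ys : List B) →
  length (cartesianProduct xs ys) ≡ length xs * length ys
length-cartesianProduct []       ys = refl
length-cartesianProduct (x ∷ xs) ys = trans (length-++ (map (x ,_) ys))
  (cong₂ _+_ (length-map (x ,_) ys) (length-cartesianProduct xs ys))

length-cartesianProduct³ : ∀ {C : Set} (xs : List A) (ys : List B) (zs : List C) →
  length (cartesianProduct xs (cartesianProduct ys zs)) ≡ length xs * (length ys * length zs)
length-cartesianProduct³ xs ys zs =
  trans (length-cartesianProduct xs _) (cong (length xs *_) (length-cartesianProduct ys zs))

Unique-⊆⇒length≤ : {xs ys : List A} → Unique xs → xs ⊆ ys → length xs ≤ length ys
Unique-⊆⇒length≤                 []             _     = z≤n
Unique-⊆⇒length≤ {xs = x ∷ xs} (x∉xs ∷ xs-unique) xs⊆ys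
  with us , vs , refl ← ∈-∃++ (xs⊆ys (here refl)) = begin
    suc (length xs)          ≤⟨ s≤s (Unique-⊆⇒length≤ xs-unique xs⊆us++vs) ⟩
    suc (length (us ++ vs))  ≡⟨ length-++-sucʳ us x vs ⟨
    length (us ++ x ∷ vs)    ∎
  where
  open ≤-Reasoning
  xs⊆us++vs : xs ⊆ us ++ vs
  xs⊆us++vs {v} v∈xs with ∈-++⁻ us (xs⊆ys (there v∈xs))
  ... | inj₁ v∈us          = ∈-++⁺ˡ v∈us
  ... | inj₂ (here v≡x)    = contradiction (sym v≡x) (All.lookup x∉xs v∈xs)
  ... | inj₂ (there v∈vs)  = ∈-++⁺ʳ us v∈vs

consecutive-map : (f : A → B) (xs : List A) →
  consecutive (map f xs) ≡ map (Product.map f f) (consecutive xs)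
consecutive-map f []           = refl
consecutive-map f (x ∷ [])     = refl
consecutive-map f (x ∷ y ∷ xs) = cong ((f x , f y) ∷_) (consecutive-map f (y ∷ xs))

length-concatMap : ∀ {m} (f : A → List B) → (∀ x → length (f x) ≡ m) →
  ∀ xs → length (concatMap f xs) ≡ length xs * m
length-concatMap f lf []       = refl
length-concatMap f lf (x ∷ xs) = trans (length-++ (f x)) (cong₂ _+_ (lf x) (length-concatMap f lf xs))

allWords-Unique : ∀ n → Unique (allWords n)
allWords-Unique zero    = All.[] ∷ []
allWords-Unique (suc n) = Unique.++⁺ (prefixed false) (prefixed true) heads-differ
  where
  prefixed : ∀ b → Unique (map (b ∷_) (allWords n))
  prefixed b = Unique.map⁺ ∷-injectiveʳ (allWords-Unique n)
  heads-differ : DisjointLists (map (false ∷_) (allWords n)) (map (true ∷_) (allWords n))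
  heads-differ (v∈false , v∈true) with ∈-map⁻ (false ∷_) v∈false | ∈-map⁻ (true ∷_) v∈true
  ... | _ , _ , refl | _ , _ , ()

allQuads-Unique : ∀ n → Unique (allQuads n)
allQuads-Unique n =
  Unique.cartesianProduct⁺ words (Unique.cartesianProduct⁺ words (Unique.cartesianProduct⁺ words words))
  where words = allWords-Unique n

ofWeight : ∀ n → ℕ → List (Word n)
ofWeight zero    zero    = [] ∷ []
ofWeight zero    (suc k) = []
ofWeight (suc n) zero    = map (false ∷_) (ofWeight n zero)
ofWeight (suc n) (suc k) = map (true ∷_) (ofWeight n k) ++ map (false ∷_) (ofWeight n (suc k))

length-ofWeight : ∀ n k → length (ofWeight n k) ≡ n C k
length-ofWeight zero    zero    = refl
length-ofWeight zero    (suc k) = refl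
length-ofWeight (suc n) zero    = trans (length-map (false ∷_) (ofWeight n zero)) (length-ofWeight n zero)
length-ofWeight (suc n) (suc k) = begin
  length (map (true ∷_) (ofWeight n k) ++ map (false ∷_) (ofWeight n (suc k)))
    ≡⟨ length-++ (map (true ∷_) (ofWeight n k)) ⟩
  length (map (true ∷_) (ofWeight n k)) + length (map (false ∷_) (ofWeight n (suc k)))
    ≡⟨ cong₂ _+_ (length-map (true ∷_) (ofWeight n k)) (length-map (false ∷_) (ofWeight n (suc k))) ⟩
  length (ofWeight n k) + length (ofWeight n (suc k))
    ≡⟨ cong₂ _+_ (length-ofWeight n k) (length-ofWeight n (suc k)) ⟩
  n C k + n C suc k
    ≡⟨ nCk+nC[k+1]≡[n+1]C[k+1] n k ⟩
  suc n C suc k ∎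
  where open ≡-Reasoning

∈-ofWeight : ∀ {k} (w : Word n) → weight w ≡ k → w ∈ ofWeight n k
∈-ofWeight {k = zero}  []          refl = here refl
∈-ofWeight {k = zero}  (false ∷ w) w≡0  = ∈-map⁺ (false ∷_) (∈-ofWeight w w≡0)
∈-ofWeight {k = suc k} (true ∷ w)  w≡k  = ∈-++⁺ˡ (∈-map⁺ (true ∷_) (∈-ofWeight w (suc-injective w≡k)))
∈-ofWeight {suc n} {k = suc k} (false ∷ w) w≡k =
  ∈-++⁺ʳ (map (true ∷_) (ofWeight n k)) (∈-map⁺ (false ∷_) (∈-ofWeight w w≡k))

nCk≤[1+n]Ck : ∀ n k → n C k ≤ suc n C k
nCk≤[1+n]Ck n zero    = ≤-refl
nCk≤[1+n]Ck n (suc k) = ≤-trans (m≤n+m (n C suc k) (n C k)) (≤-reflexive (nCk+nC[k+1]≡[n+1]C[k+1] n k))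

nC[i+j]≤nCi*nCj : ∀ n i j → n C (i + j) ≤ (n C i) * (n C j)
nC[i+j]≤nCi*nCj n       zero    j = ≤-reflexive (sym (+-identityʳ (n C j)))
nC[i+j]≤nCi*nCj zero    (suc i) j = z≤n
nC[i+j]≤nCi*nCj (suc n) (suc i) j = begin
  suc n C suc (i + j)                          ≡⟨ nCk+nC[k+1]≡[n+1]C[k+1] n (i + j) ⟨
  n C (i + j) + n C (suc i + j)                ≤⟨ +-mono-≤ (nC[i+j]≤nCi*nCj n i j) (nC[i+j]≤nCi*nCj n (suc i) j) ⟩
  (n C i) * (n C j) + (n C suc i) * (n C j)    ≡⟨ *-distribʳ-+ (n C j) (n C i) (n C suc i) ⟨
  (n C i + n C suc i) * (n C j)                ≡⟨ cong (_* (n C j)) (nCk+nC[k+1]≡[n+1]C[k+1] n i) ⟩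
  (suc n C suc i) * (n C j)                    ≤⟨ *-monoʳ-≤ (suc n C suc i) (nCk≤[1+n]Ck n j) ⟩
  (suc n C suc i) * (suc n C j)                ∎
  where open ≤-Reasoning

nC[k*d]≤nCd^k : ∀ n k d → n C (k * d) ≤ (n C d) ^ k
nC[k*d]≤nCd^k n zero    d = ≤-refl
nC[k*d]≤nCd^k n (suc k) d = ≤-trans (nC[i+j]≤nCi*nCj n d (k * d)) (*-monoʳ-≤ (n C d) (nC[k*d]≤nCd^k n k d))

quadFrom : Word n → Word n × Word n × Word n → Quad n
quadFrom x (z , t , u) = (x , x ⊕ z , t , u)

quadFrom-recover : ∀ {x y o p : Word n} t u → x ⊕ o ≡ p → quadFrom (p ⊕ o) (x ⊕ y , t , u) ≡ (x , y , t , u)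
quadFrom-recover {x = x} {y} {o} t u refl rewrite ⊕-cancelʳ x o = cong (λ v → (x , v , t , u)) (⊕-cancelˡ x y)

placements : Word n → Word n → Word n × Word n × Word n → Word n × Word n → List (Quad n)
placements a b ztu (o , _) = quadFrom (a ⊕ o) ztu ∷ quadFrom (b ⊕ o) ztu ∷ []

endpoints-⊕ : ∀ {x o o′ p r : Word n} → x ⊕ o ≡ p → x ⊕ o′ ≡ r → p ⊕ r ≡ o ⊕ o′
endpoints-⊕ {x = x} {o} {o′} refl refl = ⊕-cancel-common x o o′

module _ (d : ℕ) where

  offsets : Word n → Word n → Word n → List (Word n)
  offsets {n} z t u = zeros n ∷ t ∷ t ⊕ u ∷ (t ⊕ u) ⊕ F₁ ∷ ((t ⊕ u) ⊕ F₁) ⊕ F₂ ∷ (z ⊕ t) ⊕ u ∷ z ⊕ u ∷ z ∷ []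
    where
    F₁ = firstOnes d z
    F₂ = firstOnes d (z ⊕ F₁)

  templateEdges : Word n → Word n → Word n → List (Word n × Word n)
  templateEdges z t u = consecutive (offsets z t u)

  pathVertices-translate : (x y t u : Word n) →
    pathVertices d (x , y , t , u) ≡ map (x ⊕_) (offsets (x ⊕ y) t u)
  pathVertices-translate x y t u = ListPointwise.Pointwise-≡⇒≡
    ( sym (⊕-identityʳ x) ∷ refl ∷ ⊕-translate refl ∷ ⊕-translate (⊕-translate refl)
    ∷ ⊕-translate (⊕-translate (⊕-translate refl)) ∷ ⊕-translate (⊕-translate y≡) ∷ ⊕-translate y≡ ∷ y≡ ∷ [])
    where
    y≡ : y ≡ x ⊕ (x ⊕ y)
    y≡ = sym (⊕-cancelˡ x y)

  PureStep : (z t u s : Word n) → Set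
  PureStep z t u s = s ≡ t ⊎ s ≡ u ⊎ s ⊑ z

  templateEdges-pure : (z t u : Word n) →
    All (Product.uncurry λ o o′ → PureStep z t u (o ⊕ o′)) (templateEdges z t u)
  templateEdges-pure z t u =
    inj₁ (⊕-identityˡ t) ∷ inj₂ (inj₁ (⊕-cancelˡ t u)) ∷
    inj₂ (inj₂ (⊑-subst (⊕-cancelˡ w F₁) F₁⊑z)) ∷ inj₂ (inj₂ (⊑-subst (⊕-cancelˡ (w ⊕ F₁) F₂) F₂⊑z)) ∷
    inj₂ (inj₂ (⊑-subst middle-step F₃⊑z)) ∷ inj₁ last-t ∷ inj₂ (inj₁ last-u) ∷ []
    where
    open ≡-Reasoning
    w  = t ⊕ u
    F₁ = firstOnes d z
    F₂ = firstOnes d (z ⊕ F₁)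
    ⊑-subst : ∀ {s s′} → s ≡ s′ → s′ ⊑ z → s ⊑ z
    ⊑-subst refl s⊑z = s⊑z
    F₁⊑z : F₁ ⊑ z
    F₁⊑z = firstOnes-⊑ d z
    F₂⊑z⊕F₁ : F₂ ⊑ z ⊕ F₁
    F₂⊑z⊕F₁ = firstOnes-⊑ d (z ⊕ F₁)
    F₂⊑z : F₂ ⊑ z
    F₂⊑z = ⊑-trans F₂⊑z⊕F₁ (⊕-⊑ F₁⊑z)
    F₃⊑z : (z ⊕ F₁) ⊕ F₂ ⊑ z
    F₃⊑z = ⊑-trans (⊕-⊑ F₂⊑z⊕F₁) (⊕-⊑ F₁⊑z)
    middle-step : ((w ⊕ F₁) ⊕ F₂) ⊕ ((z ⊕ t) ⊕ u) ≡ (z ⊕ F₁) ⊕ F₂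
    middle-step = begin
      ((w ⊕ F₁) ⊕ F₂) ⊕ ((z ⊕ t) ⊕ u)  ≡⟨ cong₂ _⊕_ (⊕-assoc w F₁ F₂) (⊕-assoc z t u) ⟩
      (w ⊕ (F₁ ⊕ F₂)) ⊕ (z ⊕ w)        ≡⟨ cong ((w ⊕ (F₁ ⊕ F₂)) ⊕_) (⊕-comm z w) ⟩
      (w ⊕ (F₁ ⊕ F₂)) ⊕ (w ⊕ z)        ≡⟨ ⊕-cancel-common w (F₁ ⊕ F₂) z ⟩
      (F₁ ⊕ F₂) ⊕ z                    ≡⟨ ⊕-comm (F₁ ⊕ F₂) z ⟩
      z ⊕ (F₁ ⊕ F₂)                    ≡⟨ ⊕-assoc z F₁ F₂ ⟨
      (z ⊕ F₁) ⊕ F₂                    ∎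
    last-t : ((z ⊕ t) ⊕ u) ⊕ (z ⊕ u) ≡ t
    last-t = begin
      ((z ⊕ t) ⊕ u) ⊕ (z ⊕ u)  ≡⟨ cong (_⊕ (z ⊕ u)) (⊕-assoc z t u) ⟩
      (z ⊕ w) ⊕ (z ⊕ u)        ≡⟨ ⊕-cancel-common z w u ⟩
      (t ⊕ u) ⊕ u              ≡⟨ ⊕-cancelʳ t u ⟩
      t                        ∎
    last-u : (z ⊕ u) ⊕ z ≡ u
    last-u = trans (⊕-comm (z ⊕ u) z) (⊕-cancelˡ z u)

  EdgeAt : Word n → Word n → Word n → Word n × Word n → Set
  EdgeAt x a b (o , o′) = (x ⊕ o ≡ a × x ⊕ o′ ≡ b) ⊎ (x ⊕ o ≡ b × x ⊕ o′ ≡ a)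

  edge-in-template : ∀ {a b x y t u : Word n} → ContainsEdge d a b (x , y , t , u) →
    ∃ λ e → e ∈ templateEdges (x ⊕ y) t u × EdgeAt x a b e
  edge-in-template {x = x} {y} {t} {u} ce = find (Any.map⁻ (subst (Any _) edges-translate ce))
    where
    edges-translate : consecutive (pathVertices d (x , y , t , u))
                    ≡ map (Product.map (x ⊕_) (x ⊕_)) (templateEdges (x ⊕ y) t u)
    edges-translate = trans (cong consecutive (pathVertices-translate x y t u))
                            (consecutive-map (x ⊕_) (offsets (x ⊕ y) t u))

  triples-t≡ triples-u≡ triples-⊑ triples : Word n → List (Word n × Word n × Word n)
  triples-t≡ {n} c = cartesianProduct (ofWeight n (3 * d)) (cartesianProduct (c ∷ []) (ofWeight n d))
  triples-u≡ {n} c = cartesianProduct (ofWeight n (3 * d)) (cartesianProduct (ofWeight n d) (c ∷ []))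
  triples-⊑  {n} c =
    cartesianProduct (map (_⊕ c) (ofWeight n (2 * d))) (cartesianProduct (ofWeight n d) (ofWeight n d))
  triples c = triples-t≡ c ++ triples-u≡ c ++ triples-⊑ c

  ∈-triples : ∀ {z t u c : Word n} → weight z ≡ 3 * d → weight t ≡ d → weight u ≡ d → weight c ≡ d →
    PureStep z t u c → (z , t , u) ∈ triples c
  ∈-triples {z = z} {u = u} ∣z∣ _ ∣u∣ _ (inj₁ refl) = ∈-++⁺ˡ
    (∈-cartesianProduct⁺ (∈-ofWeight z ∣z∣) (∈-cartesianProduct⁺ {xs = _ ∷ []} (here refl) (∈-ofWeight u ∣u∣)))
  ∈-triples {z = z} {t} {c = c} ∣z∣ ∣t∣ _ _ (inj₂ (inj₁ refl)) = ∈-++⁺ʳ (triples-t≡ c) (∈-++⁺ˡ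
    (∈-cartesianProduct⁺ (∈-ofWeight z ∣z∣) (∈-cartesianProduct⁺ {ys = _ ∷ []} (∈-ofWeight t ∣t∣) (here refl))))
  ∈-triples {n} {z} {t} {u} {c} ∣z∣ ∣t∣ ∣u∣ ∣c∣ (inj₂ (inj₂ c⊑z)) =
    ∈-++⁺ʳ (triples-t≡ c) (∈-++⁺ʳ (triples-u≡ c)
      (∈-cartesianProduct⁺ z∈ (∈-cartesianProduct⁺ (∈-ofWeight t ∣t∣) (∈-ofWeight u ∣u∣))))
    where
    ∣z⊕c∣ : weight (z ⊕ c) ≡ 2 * d
    ∣z⊕c∣ = +-cancelˡ-≡ d _ _ (begin
      d + weight (z ⊕ c)         ≡⟨ +-comm d _ ⟩
      weight (z ⊕ c) + d         ≡⟨ cong (weight (z ⊕ c) +_) ∣c∣ ⟨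
      weight (z ⊕ c) + weight c  ≡⟨ weight-⊑ c⊑z ⟩
      weight z                   ≡⟨ ∣z∣ ⟩
      3 * d                      ∎)
      where open ≡-Reasoning
    z∈ : z ∈ map (_⊕ c) (ofWeight n (2 * d))
    z∈ = subst (_∈ _) (⊕-cancelʳ z c) (∈-map⁺ (_⊕ c) (∈-ofWeight (z ⊕ c) ∣z⊕c∣))

  candidatesAt : Word n → Word n → Word n × Word n × Word n → List (Quad n)
  candidatesAt a b ztu@(z , t , u) = concatMap (placements a b ztu) (templateEdges z t u)

  candidates : Word n → Word n → List (Quad n)
  candidates a b = concatMap (candidatesAt a b) (triples (a ⊕ b))

  ∈-candidates : ∀ {a b : Word n} {q} → hamming a b ≡ d → IsPure d q → ContainsEdge d a b q →
    q ∈ candidates a b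
  ∈-candidates {a = a} {b} {x , y , t , u} ∣a⊕b∣ (∣z∣ , ∣t∣ , ∣u∣ , _) ce = from-edge (edge-in-template ce)
    where
    z = x ⊕ y
    found : ∀ {o o′} → (o , o′) ∈ templateEdges z t u → a ⊕ b ≡ o ⊕ o′ →
      (x , y , t , u) ∈ candidatesAt a b (z , t , u) → (x , y , t , u) ∈ candidates a b
    found e∈ a⊕b≡ q∈ = ∈-concatMap⁺ (candidatesAt a b) (lose (∈-triples ∣z∣ ∣t∣ ∣u∣ ∣a⊕b∣ pure) q∈)
      where pure = subst (PureStep z t u) (sym a⊕b≡) (All.lookup (templateEdges-pure z t u) e∈)
    from-edge : ∃ (λ e → e ∈ templateEdges z t u × EdgeAt x a b e) → (x , y , t , u) ∈ candidates a b
    from-edge ((o , o′) , e∈ , inj₁ (xo≡a , xo′≡b)) =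
      found e∈ (endpoints-⊕ xo≡a xo′≡b)
        (∈-concatMap⁺ (placements a b (z , t , u)) (lose e∈ (here (sym (quadFrom-recover t u xo≡a)))))
    from-edge ((o , o′) , e∈ , inj₂ (xo≡b , xo′≡a)) =
      found e∈ (trans (⊕-comm a b) (endpoints-⊕ xo≡b xo′≡a))
        (∈-concatMap⁺ (placements a b (z , t , u)) (lose e∈ (there (here (sym (quadFrom-recover t u xo≡b))))))

  length-candidates : (a b : Word n) → length (candidates a b) ≡ length (triples (a ⊕ b)) * 14
  length-candidates a b = length-concatMap (candidatesAt a b) fourteen (triples (a ⊕ b))
    where
    fourteen : ∀ ztu → length (candidatesAt a b ztu) ≡ 14
    fourteen ztu@(z , t , u) = length-concatMap {m = 2} (placements a b ztu) (λ _ → refl) (templateEdges z t u)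

  length-triples : ∀ n (c : Word n) → length (triples c) ≤ 3 * (n C d) ^ 4
  length-triples n c = begin
    length (triples c)
      ≡⟨ length-++ (triples-t≡ c) ⟩
    length (triples-t≡ c) + length (triples-u≡ c ++ triples-⊑ c)
      ≡⟨ cong (length (triples-t≡ c) +_) (length-++ (triples-u≡ c)) ⟩
    length (triples-t≡ c) + (length (triples-u≡ c) + length (triples-⊑ c))
      ≡⟨ cong₂ _+_ (length-cartesianProduct³ (ofWeight n (3 * d)) (c ∷ []) (ofWeight n d))
           (cong₂ _+_ (length-cartesianProduct³ (ofWeight n (3 * d)) (ofWeight n d) (c ∷ []))
                      (length-cartesianProduct³ (map (_⊕ c) (ofWeight n (2 * d))) (ofWeight n d) (ofWeight n d))) ⟩
    ∣W₃∣ * (1 * ∣W₁∣) + (∣W₃∣ * (∣W₁∣ * 1) + ∣c⊕W₂∣ * (∣W₁∣ * ∣W₁∣))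
      ≤⟨ +-mono-≤ (*-mono-≤ (∣W∣≤ 3) (*-monoʳ-≤ 1 ∣W₁∣≤))
           (+-mono-≤ (*-mono-≤ (∣W∣≤ 3) (*-monoˡ-≤ 1 ∣W₁∣≤)) (*-mono-≤ ∣c⊕W₂∣≤ (*-mono-≤ ∣W₁∣≤ ∣W₁∣≤))) ⟩
    D ^ 3 * (1 * D) + (D ^ 3 * (D * 1) + D ^ 2 * (D * D))
      ≡⟨ solve 1 (λ X → X :^ 3 :* (con 1 :* X) :+ (X :^ 3 :* (X :* con 1) :+ X :^ 2 :* (X :* X))
                        := con 3 :* X :^ 4) refl D ⟩
    3 * D ^ 4 ∎
    where
    open ≤-Reasoning
    open +-*-Solver
    D = n C d
    ∣W₁∣ = length (ofWeight n d)
    ∣c⊕W₂∣ = length (map (_⊕ c) (ofWeight n (2 * d)))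
    ∣W₃∣ = length (ofWeight n (3 * d))
    ∣W∣≤ : ∀ k → length (ofWeight n (k * d)) ≤ D ^ k
    ∣W∣≤ k = ≤-trans (≤-reflexive (length-ofWeight n (k * d))) (nC[k*d]≤nCd^k n k d)
    ∣W₁∣≤ : ∣W₁∣ ≤ D
    ∣W₁∣≤ = ≤-reflexive (length-ofWeight n d)
    ∣c⊕W₂∣≤ : ∣c⊕W₂∣ ≤ D ^ 2
    ∣c⊕W₂∣≤ = ≤-trans (≤-reflexive (length-map (_⊕ c) (ofWeight n (2 * d)))) (∣W∣≤ 2)

lemma3p3 : ∃ λ (K : ℕ) → ∀ (n d : ℕ) → 1 ≤ n → 1 ≤ d → (a b : Word n) → hamming a b ≡ d →
    pureCount d a b ≤ K * 3 ^ (3 * d) * (n C d) ^ 4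
lemma3p3 = 42 , λ n d _ _ a b ∣a⊕b∣ →
  let open ≤-Reasoning
      P? = λ q → isPure? d q ×-dec containsEdge? d a b q
      D⁴ = (n C d) ^ 4
  in begin
    pureCount d a b
      ≤⟨ Unique-⊆⇒length≤ (Unique.filter⁺ P? (allQuads-Unique n))
           (λ q∈ → let _ , pure , ce = ∈-filter⁻ P? {xs = allQuads n} q∈ in ∈-candidates d ∣a⊕b∣ pure ce) ⟩
    length (candidates d a b)
      ≡⟨ length-candidates d a b ⟩
    length (triples d (a ⊕ b)) * 14
      ≤⟨ *-monoˡ-≤ 14 (length-triples d n (a ⊕ b)) ⟩
    3 * D⁴ * 14
      ≡⟨ *-comm (3 * D⁴) 14 ⟩
    14 * (3 * D⁴)
      ≡⟨ *-assoc 14 3 D⁴ ⟨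
    42 * D⁴
      ≤⟨ *-monoˡ-≤ D⁴ (m≤m*n 42 (3 ^ (3 * d)) {{m^n≢0 3 (3 * d)}}) ⟩
    42 * 3 ^ (3 * d) * D⁴ ∎
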